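{- For every constant specification $CS$ for $\mathcal{GJ}4_0$: $(Th_{\mathcal{GJ}4_{CS}})^\circ\subsetneq Th_{\mathcal{GK}4_\Box}$.
   Context: Justification terms $Jt$ are generated by $t::= c\mid x\mid [t+t]\mid [t\cdot t]\mid\, !t\mid\, ?t$, where $c$ ranges over constants $C=\{c_i\mid i\in\mathbb{N}\}$ and $x$ over variables $V=\{x_i\}$. The language $\mathcal{L}_J$ is $\phi::=\bot\mid p\mid(\phi\rightarrow\phi)\mid(\phi\land\phi)\mid t:\phi$ with $p\in Var=\{p_i\mid i\in\mathbb{N}\}$; $\neg\phi:=\phi\rightarrow\bot$. The modal language $\mathcal{L}_\Box$ is $\phi::=\bot\mid p\mid(\phi\land\phi)\mid(\phi\rightarrow\phi)\mid\Box\phi$. The calculus $\mathcal{G}$ has the axiom schemes (A1) $(\phi\rightarrow\psi)\rightarrow((\psi\rightarrow\chi)\rightarrow(\phi\rightarrow\chi))$; (A2) $(\phi\land\psi)\rightarrow\phi$; (A3) $(\phi\land\psi)\rightarrow(\psi\land\phi)$; (A5a) $(\phi\rightarrow(\psi\rightarrow\chi))\rightarrow((\phi\land\psi)\rightarrow\chi)$; (A5b) $((\phi\land\psi)\rightarrow\chi)\rightarrow(\phi\rightarrow(\psi\rightarrow\chi))$; (A6) $((\phi\rightarrow\psi)\rightarrow\chi)\rightarrow(((\psi\rightarrow\phi)\rightarrow\chi)\rightarrow\chi)$; (A7) $\bot\rightarrow\phi$; (G4) $\phi\rightarrow(\phi\land\phi)$; and the rule (MP): from $\phi\rightarrow\psi$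 and $\phi$ infer $\psi$. $\mathcal{GJ}4_0$ is $\mathcal{G}$ over $\mathcal{L}_J$ plus (J) $t:(\phi\rightarrow\psi)\rightarrow(s:\phi\rightarrow[t\cdot s]:\psi)$, (+) $t:\phi\rightarrow[t+s]:\phi$, $s:\phi\rightarrow[t+s]:\phi$, and (!) $t:\phi\rightarrow\, !t:t:\phi$. A constant specification for $\mathcal{GJ}4_0$ is a set $CS$ of formulas $c_{i_n}:\dots:c_{i_1}:\phi$ ($n\ge1$, $c_{i_k}\in C$, $\phi$ an axiom instance of $\mathcal{GJ}4_0$) such that whenever $c_{i_n}:\dots:c_{i_1}:\phi\in CS$, also $c_{i_k}:\dots:c_{i_1}:\phi\in CS$ for all $k\le n$. $\mathcal{GJ}4_{CS}$ is $\mathcal{GJ}4_0$ plus the rule: from $c:\phi\in CS$ infer $c:\phi$. $\mathcal{GK}4_\Box$ over $\mathcal{L}_\Box$ consists of the axiom schemes of $\mathcal{G}$, (K) $\Box(\phi\rightarrow\psi)\rightarrow(\Box\phi\rightarrow\Box\psi)$, (Z) $\neg\neg\Box\phi\rightarrow\Box\neg\neg\phi$, (4) $\Box\phi\rightarrow\Box\Box\phi$, the rule (MP), and the rule (N$\Box$): from a theorem $\phi$ infer $\Box\phi$. For a proof system $\mathcal{S}$ over $\mathcal{L}$, $Th_\mathcal{S}=\{\phi\in\mathcal{L}\mid\ \vdash_\mathcal{S}\phi\}$. The forgetful projection $\circ:\mathcal{L}_J\to\mathcal{L}_\Box$ is given by $p^\circ=p$, $\bot^\circ=\bot$, $(\phi\land\psi)^\circ=\phi^\circ\land\psi^\circ$,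 $(\phi\rightarrow\psi)^\circ=\phi^\circ\rightarrow\psi^\circ$, $(t:\phi)^\circ=\Box\phi^\circ$, and $\Gamma^\circ=\{\phi^\circ\mid\phi\in\Gamma\}$. -}

module Defs where

open import Data.Nat using (ℕ)
open import Data.List using (List; []; _∷_; _++_)
open import Data.Product using (Σ; ∃; _×_; _,_)
open import Relation.Binary.PropositionalEquality using (_≡_)
open import Relation.Nullary using (¬_)

data Tm : Set where
  cst  : ℕ → Tm
  var  : ℕ → Tm
  _⊕_  : Tm → Tm → Tm
  _⊙_  : Tm → Tm → Tm
  !_   : Tm → Tm
  ¿_   : Tm → Tm

infixr 5 _⇒_
infixr 6 _∧_
infixr 7 _∶_

data FmJ : Set where
  ⊥J   : FmJ
  atom : ℕ → FmJ
  _⇒_  : FmJ → FmJ → FmJ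
  _∧_  : FmJ → FmJ → FmJ
  _∶_  : Tm → FmJ → FmJ

infixr 5 _⇒□_
infixr 6 _∧□_

data Fm□ : Set where
  ⊥□    : Fm□
  atom□ : ℕ → Fm□
  _∧□_  : Fm□ → Fm□ → Fm□
  _⇒□_  : Fm□ → Fm□ → Fm□
  □_    : Fm□ → Fm□

¬J : FmJ → FmJ
¬J φ = φ ⇒ ⊥J

¬□ : Fm□ → Fm□
¬□ φ = φ ⇒□ ⊥□

record PropLang (F : Set) : Set where
  field
    bot : F
    imp : F → F → F
    con : F → F → F

module _ {F : Set} (L : PropLang F) where
  open PropLang L

  data AxG : F → Set where
    A1  : ∀ φ ψ χ → AxG (imp (imp φ ψ) (imp (imp ψ χ) (imp φ χ)))
    A2  : ∀ φ ψ → AxG (imp (con φ ψ) φ)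
    A3  : ∀ φ ψ → AxG (imp (con φ ψ) (con ψ φ))
    A5a : ∀ φ ψ χ → AxG (imp (imp φ (imp ψ χ)) (imp (con φ ψ) χ))
    A5b : ∀ φ ψ χ → AxG (imp (imp (con φ ψ) χ) (imp φ (imp ψ χ)))
    A6  : ∀ φ ψ χ → AxG (imp (imp (imp φ ψ) χ) (imp (imp (imp ψ φ) χ) χ))
    A7  : ∀ φ → AxG (imp bot φ)
    G4  : ∀ φ → AxG (imp φ (con φ φ))

LJ : PropLang FmJ
LJ = record { bot = ⊥J ; imp = _⇒_ ; con = _∧_ }

L□ : PropLang Fm□
L□ = record { bot = ⊥□ ; imp = _⇒□_ ; con = _∧□_ }

data AxGJ4 : FmJ → Set where
  axG   : ∀ {φ} → AxG LJ φ → AxGJ4 φ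
  axJ   : ∀ t s φ ψ → AxGJ4 (t ∶ (φ ⇒ ψ) ⇒ (s ∶ φ ⇒ (t ⊙ s) ∶ ψ))
  axPl  : ∀ t s φ → AxGJ4 (t ∶ φ ⇒ (t ⊕ s) ∶ φ)
  axPr  : ∀ t s φ → AxGJ4 (s ∶ φ ⇒ (t ⊕ s) ∶ φ)
  axBang : ∀ t φ → AxGJ4 (t ∶ φ ⇒ (! t) ∶ t ∶ φ)

data ⊢GJ4₀_ : FmJ → Set where
  ax : ∀ {φ} → AxGJ4 φ → ⊢GJ4₀ φ
  mp : ∀ {φ ψ} → ⊢GJ4₀ (φ ⇒ ψ) → ⊢GJ4₀ φ → ⊢GJ4₀ ψ

-- cchain (i_n ∷ … ∷ i_1 ∷ []) φ  =  c_{i_n} : … : c_{i_1} : φ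
cchain : List ℕ → FmJ → FmJ
cchain []       φ = φ
cchain (i ∷ is) φ = cst i ∶ cchain is φ

-- A constant specification is a set (predicate) CS of formulas such that
--  * every member has the form c_{i_n}:…:c_{i_1}:φ with n ≥ 1 and φ an
--    axiom instance of GJ4_0, and
--  * it is closed under taking the chains c_{i_k}:…:c_{i_1}:φ, k ≤ n
--    (i.e. nonempty suffixes of the list of constants).
record IsCS (CS : FmJ → Set) : Set where
  field
    shape  : ∀ χ → CS χ →
             Σ ℕ λ i → Σ (List ℕ) λ is → Σ FmJ λ φ →
               AxGJ4 φ × (χ ≡ cchain (i ∷ is) φ)
    closed : ∀ (js : List ℕ) (i : ℕ) (is : List ℕ) (φ : FmJ) → AxGJ4 φ →
             CS (cchain (js ++ (i ∷ is)) φ) → CS (cchain (i ∷ is) φ)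

data ⊢GJ4[_]_ (CS : FmJ → Set) : FmJ → Set where
  ax  : ∀ {φ} → AxGJ4 φ → ⊢GJ4[ CS ] φ
  mp  : ∀ {φ ψ} → ⊢GJ4[ CS ] (φ ⇒ ψ) → ⊢GJ4[ CS ] φ → ⊢GJ4[ CS ] ψ
  ics : ∀ c φ → CS (cst c ∶ φ) → ⊢GJ4[ CS ] (cst c ∶ φ)

data AxGK4 : Fm□ → Set where
  axG : ∀ {φ} → AxG L□ φ → AxGK4 φ
  axK : ∀ φ ψ → AxGK4 (□ (φ ⇒□ ψ) ⇒□ (□ φ ⇒□ □ ψ))
  axZ : ∀ φ → AxGK4 (¬□ (¬□ (□ φ)) ⇒□ □ (¬□ (¬□ φ)))
  ax4 : ∀ φ → AxGK4 (□ φ ⇒□ □ □ φ)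

data ⊢GK4_ : Fm□ → Set where
  ax  : ∀ {φ} → AxGK4 φ → ⊢GK4 φ
  mp  : ∀ {φ ψ} → ⊢GK4 (φ ⇒□ ψ) → ⊢GK4 φ → ⊢GK4 ψ
  nec : ∀ {φ} → ⊢GK4 φ → ⊢GK4 (□ φ)

_° : FmJ → Fm□
⊥J ° = ⊥□
atom p ° = atom□ p
(φ ⇒ ψ) ° = φ ° ⇒□ ψ °
(φ ∧ ψ) ° = φ ° ∧□ ψ °
(t ∶ φ) ° = □ (φ °)

InProjTh : (CS : FmJ → Set) → Fm□ → Set
InProjTh CS ψ = Σ FmJ λ φ → (⊢GJ4[ CS ] φ) × (φ ° ≡ ψ)

ProjStrictSub : (CS : FmJ → Set) → Set
ProjStrictSub CS =
  (∀ ψ → InProjTh CS ψ → ⊢GK4 ψ) ×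
  (Σ Fm□ λ ψ → (⊢GK4 ψ) × ¬ InProjTh CS ψ)

-- Every axiom of GJ4_0 projects to a theorem of GK4 (the +-axioms to instances of
-- □φ → □φ) and constant specification members project to necessitated axioms, so
-- the projection of GJ4_CS lies in GK4. For strictness, evaluate modal formulas in
-- the three-element Gödel algebra 0 < ½ < 1 with □a = max(a, ½): all projected
-- theorems get value 1, but the instance ¬¬□p → □¬¬p of (Z) gets value ½ when p = 0.
module Submission where

open import Defs
open import Data.Nat using (ℕ)
open import Data.List using ([]; _∷_)
open import Data.Product using (_,_)
open import Relation.Binary.PropositionalEquality using (_≡_; refl; cong; subst)
open import Relation.Nullary using (¬_; Dec; yes; no)
open import Relation.Nullary.Decidable using (True; toWitness)
open import Relation.Unary using (Decidable)

module _ (Q : Fm□ → Set)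
         (Q-axiom : ∀ {φ} → AxGJ4 φ → Q (φ °))
         (Q-mp : ∀ {φ ψ} → Q (φ ⇒□ ψ) → Q φ → Q ψ)
         (Q-nec : ∀ {φ} → Q φ → Q (□ φ))
  where

  cchain-°-closed : ∀ is {φ} → AxGJ4 φ → Q (cchain is φ °)
  cchain-°-closed []       a = Q-axiom a
  cchain-°-closed (_ ∷ is) a = Q-nec (cchain-°-closed is a)

  °-closed : ∀ {CS} → IsCS CS → ∀ {φ} → ⊢GJ4[ CS ] φ → Q (φ °)
  °-closed cs (ax a)      = Q-axiom a
  °-closed cs (mp d e)    = Q-mp (°-closed cs d) (°-closed cs e)
  °-closed cs (ics _ _ m) with IsCS.shape cs _ m
  ... | i , is , _ , a , refl = cchain-°-closed (i ∷ is) a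

AxG-° : ∀ {φ} → AxG LJ φ → AxG L□ (φ °)
AxG-° (A1 φ ψ χ)  = A1 (φ °) (ψ °) (χ °)
AxG-° (A2 φ ψ)    = A2 (φ °) (ψ °)
AxG-° (A3 φ ψ)    = A3 (φ °) (ψ °)
AxG-° (A5a φ ψ χ) = A5a (φ °) (ψ °) (χ °)
AxG-° (A5b φ ψ χ) = A5b (φ °) (ψ °) (χ °)
AxG-° (A6 φ ψ χ)  = A6 (φ °) (ψ °) (χ °)
AxG-° (A7 φ)      = A7 (φ °)
AxG-° (G4 φ)      = G4 (φ °)

⊢GK4-⇒□-refl : ∀ φ → ⊢GK4 (φ ⇒□ φ)
⊢GK4-⇒□-refl φ =
  mp (mp (ax (axG (A1 φ (φ ∧□ φ) φ))) (ax (axG (G4 φ)))) (ax (axG (A2 φ φ)))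

AxGJ4-°-⊢GK4 : ∀ {φ} → AxGJ4 φ → ⊢GK4 (φ °)
AxGJ4-°-⊢GK4 (axG a)       = ax (axG (AxG-° a))
AxGJ4-°-⊢GK4 (axJ _ _ φ ψ) = ax (axK (φ °) (ψ °))
AxGJ4-°-⊢GK4 (axPl _ _ φ)  = ⊢GK4-⇒□-refl (□ (φ °))
AxGJ4-°-⊢GK4 (axPr _ _ φ)  = ⊢GK4-⇒□-refl (□ (φ °))
AxGJ4-°-⊢GK4 (axBang _ φ)  = ax (ax4 (φ °))

°-⊢GK4 : ∀ {CS} → IsCS CS → ∀ {φ} → ⊢GJ4[ CS ] φ → ⊢GK4 (φ °)
°-⊢GK4 = °-closed ⊢GK4_ AxGJ4-°-⊢GK4 mp nec

data 𝟛 : Set where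
  𝟘 ½ 𝟙 : 𝟛

infixr 5 _⇒₃_
infixr 6 _⊓₃_

_⇒₃_ : 𝟛 → 𝟛 → 𝟛
𝟘 ⇒₃ _ = 𝟙
½ ⇒₃ 𝟘 = 𝟘
½ ⇒₃ _ = 𝟙
𝟙 ⇒₃ b = b

_⊓₃_ : 𝟛 → 𝟛 → 𝟛
𝟘 ⊓₃ _ = 𝟘
½ ⊓₃ 𝟘 = 𝟘
½ ⊓₃ _ = ½
𝟙 ⊓₃ b = b

□₃ : 𝟛 → 𝟛
□₃ 𝟙 = 𝟙
□₃ _ = ½

≡𝟙? : Decidable (_≡ 𝟙)
≡𝟙? 𝟘 = no λ ()
≡𝟙? ½ = no λ ()
≡𝟙? 𝟙 = yes refl

∀𝟛? : {P : 𝟛 → Set} → Decidable P → Dec (∀ a → P a)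
∀𝟛? P? with P? 𝟘 | P? ½ | P? 𝟙
... | yes p | yes q | yes r = yes λ { 𝟘 → p ; ½ → q ; 𝟙 → r }
... | no ¬p | _     | _     = no λ all → ¬p (all 𝟘)
... | yes _ | no ¬q | _     = no λ all → ¬q (all ½)
... | yes _ | yes _ | no ¬r = no λ all → ¬r (all 𝟙)

Tautology₁ : (𝟛 → 𝟛) → Set
Tautology₁ f = ∀ a → f a ≡ 𝟙

Tautology₂ : (𝟛 → 𝟛 → 𝟛) → Set
Tautology₂ f = ∀ a → Tautology₁ (f a)

Tautology₃ : (𝟛 → 𝟛 → 𝟛 → 𝟛) → Set
Tautology₃ f = ∀ a → Tautology₂ (f a)

tautology₁? : ∀ f → Dec (Tautology₁ f)
tautology₁? f = ∀𝟛? λ a → ≡𝟙? (f a)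

tautology₂? : ∀ f → Dec (Tautology₂ f)
tautology₂? f = ∀𝟛? λ a → tautology₁? (f a)

tautology₃? : ∀ f → Dec (Tautology₃ f)
tautology₃? f = ∀𝟛? λ a → tautology₂? (f a)

by-truth-table₁ : ∀ f → {True (tautology₁? f)} → Tautology₁ f
by-truth-table₁ f {t} = toWitness t

by-truth-table₂ : ∀ f → {True (tautology₂? f)} → Tautology₂ f
by-truth-table₂ f {t} = toWitness t

by-truth-table₃ : ∀ f → {True (tautology₃? f)} → Tautology₃ f
by-truth-table₃ f {t} = toWitness t

⇒₃-mp : ∀ {a b} → a ⇒₃ b ≡ 𝟙 → a ≡ 𝟙 → b ≡ 𝟙
⇒₃-mp e refl = e

⟦_⟧ : Fm□ → (ℕ → 𝟛) → 𝟛
⟦ ⊥□ ⟧      ρ = 𝟘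
⟦ atom□ p ⟧ ρ = ρ p
⟦ φ ∧□ ψ ⟧  ρ = ⟦ φ ⟧ ρ ⊓₃ ⟦ ψ ⟧ ρ
⟦ φ ⇒□ ψ ⟧  ρ = ⟦ φ ⟧ ρ ⇒₃ ⟦ ψ ⟧ ρ
⟦ □ φ ⟧     ρ = □₃ (⟦ φ ⟧ ρ)

Valid₃ : Fm□ → Set
Valid₃ φ = ∀ ρ → ⟦ φ ⟧ ρ ≡ 𝟙

AxG-valid₃ : ∀ {φ} → AxG L□ φ → Valid₃ φ
AxG-valid₃ (A1 φ ψ χ) ρ = by-truth-table₃ (λ a b c → (a ⇒₃ b) ⇒₃ (b ⇒₃ c) ⇒₃ a ⇒₃ c)
  (⟦ φ ⟧ ρ) (⟦ ψ ⟧ ρ) (⟦ χ ⟧ ρ)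
AxG-valid₃ (A2 φ ψ) ρ = by-truth-table₂ (λ a b → a ⊓₃ b ⇒₃ a) (⟦ φ ⟧ ρ) (⟦ ψ ⟧ ρ)
AxG-valid₃ (A3 φ ψ) ρ = by-truth-table₂ (λ a b → a ⊓₃ b ⇒₃ b ⊓₃ a) (⟦ φ ⟧ ρ) (⟦ ψ ⟧ ρ)
AxG-valid₃ (A5a φ ψ χ) ρ = by-truth-table₃ (λ a b c → (a ⇒₃ b ⇒₃ c) ⇒₃ a ⊓₃ b ⇒₃ c)
  (⟦ φ ⟧ ρ) (⟦ ψ ⟧ ρ) (⟦ χ ⟧ ρ)
AxG-valid₃ (A5b φ ψ χ) ρ = by-truth-table₃ (λ a b c → (a ⊓₃ b ⇒₃ c) ⇒₃ a ⇒₃ b ⇒₃ c)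
  (⟦ φ ⟧ ρ) (⟦ ψ ⟧ ρ) (⟦ χ ⟧ ρ)
AxG-valid₃ (A6 φ ψ χ) ρ = by-truth-table₃ (λ a b c → ((a ⇒₃ b) ⇒₃ c) ⇒₃ ((b ⇒₃ a) ⇒₃ c) ⇒₃ c)
  (⟦ φ ⟧ ρ) (⟦ ψ ⟧ ρ) (⟦ χ ⟧ ρ)
AxG-valid₃ (A7 _) _ = refl
AxG-valid₃ (G4 φ) ρ = by-truth-table₁ (λ a → a ⇒₃ a ⊓₃ a) (⟦ φ ⟧ ρ)

AxK-valid₃ : ∀ φ ψ → Valid₃ (□ (φ ⇒□ ψ) ⇒□ □ φ ⇒□ □ ψ)
AxK-valid₃ φ ψ ρ = by-truth-table₂ (λ a b → □₃ (a ⇒₃ b) ⇒₃ □₃ a ⇒₃ □₃ b) (⟦ φ ⟧ ρ) (⟦ ψ ⟧ ρ)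

Ax4-valid₃ : ∀ φ → Valid₃ (□ φ ⇒□ □ □ φ)
Ax4-valid₃ φ ρ = by-truth-table₁ (λ a → □₃ a ⇒₃ □₃ (□₃ a)) (⟦ φ ⟧ ρ)

⇒□-refl-valid₃ : ∀ φ → Valid₃ (φ ⇒□ φ)
⇒□-refl-valid₃ φ ρ = by-truth-table₁ (λ a → a ⇒₃ a) (⟦ φ ⟧ ρ)

AxGJ4-°-valid₃ : ∀ {φ} → AxGJ4 φ → Valid₃ (φ °)
AxGJ4-°-valid₃ (axG a)       = AxG-valid₃ (AxG-° a)
AxGJ4-°-valid₃ (axJ _ _ φ ψ) = AxK-valid₃ (φ °) (ψ °)
AxGJ4-°-valid₃ (axPl _ _ φ)  = ⇒□-refl-valid₃ (□ (φ °))
AxGJ4-°-valid₃ (axPr _ _ φ)  = ⇒□-refl-valid₃ (□ (φ °))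
AxGJ4-°-valid₃ (axBang _ φ)  = Ax4-valid₃ (φ °)

°-valid₃ : ∀ {CS} → IsCS CS → ∀ {φ} → ⊢GJ4[ CS ] φ → Valid₃ (φ °)
°-valid₃ = °-closed Valid₃ AxGJ4-°-valid₃
  (λ ⊨φ⇒ψ ⊨φ ρ → ⇒₃-mp (⊨φ⇒ψ ρ) (⊨φ ρ))
  (λ ⊨φ ρ → cong □₃ (⊨φ ρ))

Z-instance : Fm□
Z-instance = ¬□ (¬□ (□ (atom□ 0))) ⇒□ □ (¬□ (¬□ (atom□ 0)))

Z-instance-invalid₃ : ¬ Valid₃ Z-instance
Z-instance-invalid₃ ⊨Z with ⊨Z (λ _ → 𝟘)
... | ()

mainTheorem5 : (CS : FmJ → Set) → IsCS CS → ProjStrictSub CS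
mainTheorem5 CS cs = projection-⊆ , Z-instance , ax (axZ (atom□ 0)) , Z-instance-∉
  where
  projection-⊆ : ∀ ψ → InProjTh CS ψ → ⊢GK4 ψ
  projection-⊆ _ (_ , ⊢φ , refl) = °-⊢GK4 cs ⊢φ

  Z-instance-∉ : ¬ InProjTh CS Z-instance
  Z-instance-∉ (_ , ⊢φ , φ°≡Z) = Z-instance-invalid₃ (subst Valid₃ φ°≡Z (°-valid₃ cs ⊢φ))
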